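{- (Parallel Play Lemma.) Let $\mathcal{A}$ and $\mathcal{B}$ be two sets of pebbled $\tau$-structures (all pebbled with the same set of pebble colors), and let $r \in \mathbb{N}$. Suppose that $\mathcal{A} = \mathcal{A}_1 \sqcup \mathcal{A}_2$ and $\mathcal{B} = \mathcal{B}_1 \sqcup \mathcal{B}_2$, and that for each $i \in \{1,2\}$ Spoiler has a winning strategy $\mathcal{S}_i$ for the $r$-round multi-structural game on $(\mathcal{A}_i, \mathcal{B}_i)$, such that: (1) both strategies have the same pattern $P = \mathsf{pat}(\mathcal{S}_1) = \mathsf{pat}(\mathcal{S}_2)$; (2) at the end of the sub-games (i.e., after the $r$ rounds in which $\mathcal{S}_1$ is played on $(\mathcal{A}_1,\mathcal{B}_1)$ and $\mathcal{S}_2$ on $(\mathcal{A}_2,\mathcal{B}_2)$), there is no board arising from $\mathcal{A}_1$ and board arising from $\mathcal{B}_2$ forming a matching pair, and there is no board arising from $\mathcal{A}_2$ and board arising from $\mathcal{B}_1$ forming a matching pair. Then Spoiler wins the $r$-round multi-structural game on $(\mathcal{A}, \mathcal{B})$ with pattern $P$.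
   Context: Fix a finite vocabulary $\tau$ of relation and constant symbols. A pebbled structure $\langle \mathbf{A} \mid a_1, \ldots, a_k\rangle$ is a $\tau$-structure $\mathbf{A}$ together with pebbles of distinct colors $x_1,\dots,x_k$ (from an infinite palette) placed on elements $a_1,\dots,a_k$ (not necessarily distinct); it is also called a board. Two pebbled structures $\langle \mathbf{A} \mid a_1, \ldots, a_k\rangle$ and $\langle \mathbf{B} \mid b_1, \ldots, b_k\rangle$ (same colors) form a matching pair if the map sending $a_i \mapsto b_i$ for all $i$ and $c^{\mathbf{A}} \mapsto c^{\mathbf{B}}$ for every constant symbol $c$ is a well-defined isomorphism between the induced substructures. The $r$-round multi-structural (MS) game on $(\mathcal{A},\mathcal{B})$, where $\mathcal{A},\mathcal{B}$ are sets of pebbled structures with the same pebble colors, is played by Spoiler and Duplicator: in each round, Spoiler chooses one side ($\mathcal{A}$ or $\mathcal{B}$) and an unused color, and places a pebble of that color on an element of every board on the chosen side; Duplicator then may make any number of copies of each board on the other side and places a pebble of that color on an element of each of those boards. Duplicator wins if after round $r$ some board on side $\mathcal{A}$ and some board on side $\mathcal{B}$ form a matching pair; otherwise Spoiler wins. The pattern of a Spoiler strategy is the tuple $(Q_1,\dots,Q_r)\in\{\exists,\forall\}^r$ where $Q_i=\exists$ if Spoiler plays on side $\mathcal{A}$ in round $i$ and $Q_i=\forall$ if he plays on side $\mathcal{B}$ (strategies are considered against Duplicator's strategy of playing all possible responses, so the sides are determined by the instance). Spoiler wins with pattern $P$ if he has a winning strategy whose pattern is $P$. -}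

module Defs where

open import Level using (Level; Lift; lift) renaming (zero to lzero; suc to lsuc)
open import Data.Nat using (ℕ; zero; suc)
open import Data.Fin using (Fin)
open import Data.Vec using (Vec; map)
open import Data.Vec.Functional using (_∷_)
open import Data.Unit using (⊤)
open import Data.Sum using (_⊎_; inj₁; inj₂; [_,_])
open import Data.Product using (Σ; _×_; _,_; proj₁; proj₂)
open import Relation.Binary.PropositionalEquality using (_≡_)
open import Relation.Nullary using (¬_)
open import Function.Bundles using (_⇔_)

record Vocabulary : Set where
  field
    nRel   : ℕ
    arity  : Fin nRel → ℕ
    nConst : ℕ

module _ (τ : Vocabulary) where
  open Vocabulary τ

  record Structure : Set₁ where
    field
      Carrier : Set
      rel     : (R : Fin nRel) → Vec Carrier (arity R) → Set
      const   : Fin nConst → Carrier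

  record Board (k : ℕ) : Set₁ where
    field
      struct : Structure
      peb    : Fin k → Structure.Carrier struct

  open Structure
  open Board

  point : ∀ {k} (a : Board k) → Fin k ⊎ Fin nConst → Carrier (struct a)
  point a = [ peb a , const (struct a) ]

  -- Matching pair: a_i ↦ b_i, c^A ↦ c^B is a well-defined isomorphism
  -- between the induced substructures.
  Matching : ∀ {k} → Board k → Board k → Set
  Matching a b =
    (∀ p q → (point a p ≡ point a q) ⇔ (point b p ≡ point b q)) ×
    (∀ (R : Fin nRel) (t : Vec (Fin _ ⊎ Fin nConst) (arity R)) →
       rel (struct a) R (map (point a) t) ⇔ rel (struct b) R (map (point b) t))

  -- A side of the game: a (possibly infinite) set of boards, as an indexed family
  Side : ℕ → Set₁
  Side k = Σ Set (λ I → I → Board k)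

  _⊔_ : ∀ {k} → Side k → Side k → Side k
  (I₁ , f₁) ⊔ (I₂ , f₂) = (I₁ ⊎ I₂) , [ f₁ , f₂ ]

  SomeMatch : ∀ {k} → Side k → Side k → Set
  SomeMatch (I , f) (J , g) = Σ I λ i → Σ J λ j → Matching (f i) (g j)

  place : ∀ {k} (a : Board k) → Carrier (struct a) → Board (suc k)
  struct (place a e) = struct a
  peb    (place a e) = e ∷ peb a

  Choice : ∀ {k} → Side k → Set
  Choice (I , f) = (i : I) → Carrier (struct (f i))

  extend : ∀ {k} (A : Side k) → Choice A → Side (suc k)
  extend (I , f) c = I , λ i → place (f i) (c i)

  -- the other side after Duplicator's reply playing all possible responses
  -- (copies of every board, one for each element)
  expand : ∀ {k} → Side k → Side (suc k)
  expand (I , f) = (Σ I λ i → Carrier (struct (f i))) , λ p → place (f (proj₁ p)) (proj₂ p)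

  _⊕_ : ℕ → ℕ → ℕ
  k ⊕ zero  = k
  k ⊕ suc r = suc k ⊕ r

  Strategy : (k r : ℕ) → Side k → Side k → Set₁
  Strategy k zero    A B = Lift (lsuc lzero) ⊤
  Strategy k (suc r) A B =
    (Σ (Choice A) λ c → Strategy (suc k) r (extend A c) (expand B)) ⊎
    (Σ (Choice B) λ c → Strategy (suc k) r (expand A) (extend B c))

  data Quant : Set where
    ∃q ∀q : Quant

  pat : ∀ {k r A B} → Strategy k r A B → Vec Quant r
  pat {r = zero}  _             = Data.Vec.[]
  pat {r = suc r} (inj₁ (_ , S)) = ∃q Data.Vec.∷ pat S
  pat {r = suc r} (inj₂ (_ , S)) = ∀q Data.Vec.∷ pat S

  ends : ∀ {k r A B} → Strategy k r A B → Side (k ⊕ r) × Side (k ⊕ r)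
  ends {r = zero}  {A = A} {B = B} _ = A , B
  ends {r = suc r} (inj₁ (_ , S)) = ends S
  ends {r = suc r} (inj₂ (_ , S)) = ends S

  endA endB : ∀ {k r A B} → Strategy k r A B → Side (k ⊕ r)
  endA S = proj₁ (ends S)
  endB S = proj₂ (ends S)

  Winning : ∀ {k r A B} → Strategy k r A B → Set
  Winning S = ¬ SomeMatch (endA S) (endB S)

  WinsWithPattern : ∀ {k} (r : ℕ) → Side k → Side k → Vec Quant r → Set₁
  WinsWithPattern {k} r A B P =
    Σ (Strategy k r A B) λ S → (pat S ≡ P) × Winning S

{-# OPTIONS --safe #-}
module Submission where

open import Data.Nat using (ℕ; zero; suc)
open import Data.Product using (Σ; _×_; _,_; proj₁; proj₂)
open import Data.Sum using (inj₁; inj₂)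
open import Data.Unit using (tt)
open import Data.Vec using (_∷_)
open import Data.Vec.Properties using (∷-injectiveʳ)
open import Level using (lift)
open import Relation.Binary.PropositionalEquality using (_≡_; refl; trans; cong; subst₂)
open import Relation.Nullary using (¬_)
open import Defs

-- Since both strategies have the same pattern, Spoiler can play S₁ on the boards
-- coming from A₁, B₁ and S₂ on those coming from A₂, B₂ in the same round on the
-- same side.  Duplicator's answers on a board coming from the i-th part are answers
-- of the i-th sub-game, so every final board is a final board of one of the two
-- sub-games, and a matching pair would be one between the ends of S₁ or S₂, which
-- the hypotheses exclude.

module _ (τ : Vocabulary) where
  open Structure
  open Board

  infix 4 _∈ˢ_ _⊆ˢ_

  _∈ˢ_ : ∀ {k} → Board τ k → Side τ k → Set₁
  b ∈ˢ (I , f) = Σ I λ i → b ≡ f i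

  -- Containment of sides only up to equality of boards: extend and expand of a
  -- disjoint union are not themselves disjoint unions, but they are contained in one.
  _⊆ˢ_ : ∀ {k} → Side τ k → Side τ k → Set₁
  (I , f) ⊆ˢ B = (i : I) → f i ∈ˢ B

  ⊆ˢ-refl : ∀ {k} {A : Side τ k} → A ⊆ˢ A
  ⊆ˢ-refl {A = I , f} i = i , refl

  ⊆ˢ-trans : ∀ {k} {A B C : Side τ k} → A ⊆ˢ B → B ⊆ˢ C → A ⊆ˢ C
  ⊆ˢ-trans {A = I , f} {B = J , g} A⊆B B⊆C i =
    let j , fi≡gj = A⊆B i
        l , gj≡hl = B⊆C j
    in l , trans fi≡gj gj≡hl

  place-∈ˢ-extend : ∀ {k} {b : Board τ k} {A : Side τ k} → b ∈ˢ A → (c : Choice τ A) →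
    Σ (Carrier (struct b)) λ e → place τ b e ∈ˢ extend τ A c
  place-∈ˢ-extend {A = I , f} (i , refl) c = c i , i , refl

  place-∈ˢ-expand : ∀ {k} {b : Board τ k} {A : Side τ k} → b ∈ˢ A → (e : Carrier (struct b)) →
    place τ b e ∈ˢ expand τ A
  place-∈ˢ-expand {A = I , f} (i , refl) e = (i , e) , refl

  extend-⊆ˢ : ∀ {k} {A A′ : Side τ k} → A ⊆ˢ A′ → (c′ : Choice τ A′) →
    Σ (Choice τ A) λ c → extend τ A c ⊆ˢ extend τ A′ c′
  extend-⊆ˢ {A = I , f} A⊆A′ c′ = (λ i → proj₁ (moved i)) , (λ i → proj₂ (moved i))
    where
    moved : (i : I) → Σ (Carrier (struct (f i))) λ e → place τ (f i) e ∈ˢ extend τ _ c′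
    moved i = place-∈ˢ-extend (A⊆A′ i) c′

  expand-⊆ˢ : ∀ {k} {A A′ : Side τ k} → A ⊆ˢ A′ → expand τ A ⊆ˢ expand τ A′
  expand-⊆ˢ {A = I , f} A⊆A′ (i , e) = place-∈ˢ-expand (A⊆A′ i) e

  _⊔ᶜ_ : ∀ {k} {A₁ A₂ : Side τ k} → Choice τ A₁ → Choice τ A₂ → Choice τ (_⊔_ τ A₁ A₂)
  (c₁ ⊔ᶜ c₂) (inj₁ i) = c₁ i
  (c₁ ⊔ᶜ c₂) (inj₂ i) = c₂ i

  extend-⊔ : ∀ {k} {A₁ A₂ : Side τ k} (c₁ : Choice τ A₁) (c₂ : Choice τ A₂) →
    extend τ (_⊔_ τ A₁ A₂) (c₁ ⊔ᶜ c₂) ⊆ˢ _⊔_ τ (extend τ A₁ c₁) (extend τ A₂ c₂)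
  extend-⊔ {A₁ = _ , _} {A₂ = _ , _} c₁ c₂ (inj₁ i) = inj₁ i , refl
  extend-⊔ {A₁ = _ , _} {A₂ = _ , _} c₁ c₂ (inj₂ i) = inj₂ i , refl

  expand-⊔ : ∀ {k} {A₁ A₂ : Side τ k} →
    expand τ (_⊔_ τ A₁ A₂) ⊆ˢ _⊔_ τ (expand τ A₁) (expand τ A₂)
  expand-⊔ {A₁ = _ , _} {A₂ = _ , _} (inj₁ i , e) = inj₁ (i , e) , refl
  expand-⊔ {A₁ = _ , _} {A₂ = _ , _} (inj₂ i , e) = inj₂ (i , e) , refl

  extend-⊆ˢ-⊔ : ∀ {k} {A A₁ A₂ : Side τ k} → A ⊆ˢ _⊔_ τ A₁ A₂ →
    (c₁ : Choice τ A₁) (c₂ : Choice τ A₂) →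
    Σ (Choice τ A) λ c → extend τ A c ⊆ˢ _⊔_ τ (extend τ A₁ c₁) (extend τ A₂ c₂)
  extend-⊆ˢ-⊔ A⊆ c₁ c₂ =
    let c , A⁺⊆ = extend-⊆ˢ A⊆ (c₁ ⊔ᶜ c₂)
    in c , ⊆ˢ-trans A⁺⊆ (extend-⊔ c₁ c₂)

  expand-⊆ˢ-⊔ : ∀ {k} {A A₁ A₂ : Side τ k} → A ⊆ˢ _⊔_ τ A₁ A₂ →
    expand τ A ⊆ˢ _⊔_ τ (expand τ A₁) (expand τ A₂)
  expand-⊆ˢ-⊔ A⊆ = ⊆ˢ-trans (expand-⊆ˢ A⊆) expand-⊔

  parallel-play : ∀ {k} r {A B A₁ A₂ B₁ B₂ : Side τ k}
    (S₁ : Strategy τ k r A₁ B₁) (S₂ : Strategy τ k r A₂ B₂) → pat τ S₁ ≡ pat τ S₂ →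
    A ⊆ˢ _⊔_ τ A₁ A₂ → B ⊆ˢ _⊔_ τ B₁ B₂ →
    Σ (Strategy τ k r A B) λ S → pat τ S ≡ pat τ S₁ ×
      endA τ S ⊆ˢ _⊔_ τ (endA τ S₁) (endA τ S₂) ×
      endB τ S ⊆ˢ _⊔_ τ (endB τ S₁) (endB τ S₂)
  parallel-play zero _ _ _ A⊆ B⊆ = lift tt , refl , A⊆ , B⊆
  parallel-play (suc r) (inj₁ (c₁ , T₁)) (inj₁ (c₂ , T₂)) same-pat A⊆ B⊆ =
    let c , A⁺⊆ = extend-⊆ˢ-⊔ A⊆ c₁ c₂
        T , pat-T , ends-⊆ = parallel-play r T₁ T₂ (∷-injectiveʳ same-pat) A⁺⊆ (expand-⊆ˢ-⊔ B⊆)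
    in inj₁ (c , T) , cong (∃q ∷_) pat-T , ends-⊆
  parallel-play (suc r) (inj₂ (c₁ , T₁)) (inj₂ (c₂ , T₂)) same-pat A⊆ B⊆ =
    let c , B⁺⊆ = extend-⊆ˢ-⊔ B⊆ c₁ c₂
        T , pat-T , ends-⊆ = parallel-play r T₁ T₂ (∷-injectiveʳ same-pat) (expand-⊆ˢ-⊔ A⊆) B⁺⊆
    in inj₂ (c , T) , cong (∀q ∷_) pat-T , ends-⊆
  parallel-play (suc r) (inj₁ _) (inj₂ _) () _ _
  parallel-play (suc r) (inj₂ _) (inj₁ _) () _ _

  SomeMatch-⊆ˢ : ∀ {k} {A A′ B B′ : Side τ k} → A ⊆ˢ A′ → B ⊆ˢ B′ →
    SomeMatch τ A B → SomeMatch τ A′ B′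
  SomeMatch-⊆ˢ {A = _ , _} {A′ = _ , _} {B = _ , _} {B′ = _ , _} A⊆ B⊆ (i , j , match) =
    let i′ , fi≡ = A⊆ i
        j′ , gj≡ = B⊆ j
    in i′ , j′ , subst₂ (Matching τ) fi≡ gj≡ match

  ¬SomeMatch-⊔ : ∀ {k} {A₁ A₂ B₁ B₂ : Side τ k} →
    ¬ SomeMatch τ A₁ B₁ → ¬ SomeMatch τ A₁ B₂ → ¬ SomeMatch τ A₂ B₁ → ¬ SomeMatch τ A₂ B₂ →
    ¬ SomeMatch τ (_⊔_ τ A₁ A₂) (_⊔_ τ B₁ B₂)
  ¬SomeMatch-⊔ {A₁ = _ , _} {A₂ = _ , _} {B₁ = _ , _} {B₂ = _ , _} no₁₁ no₁₂ no₂₁ no₂₂ = λ where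
    (inj₁ i , inj₁ j , match) → no₁₁ (i , j , match)
    (inj₁ i , inj₂ j , match) → no₁₂ (i , j , match)
    (inj₂ i , inj₁ j , match) → no₂₁ (i , j , match)
    (inj₂ i , inj₂ j , match) → no₂₂ (i , j , match)

lemma3p3 : (τ : Vocabulary) (k r : ℕ) (A₁ A₂ B₁ B₂ : Side τ k)
    (S₁ : Strategy τ k r A₁ B₁) (S₂ : Strategy τ k r A₂ B₂) →
    Winning τ S₁ → Winning τ S₂ →
    pat τ S₁ ≡ pat τ S₂ →
    ¬ SomeMatch τ (endA τ S₁) (endB τ S₂) →
    ¬ SomeMatch τ (endA τ S₂) (endB τ S₁) →
    WinsWithPattern τ r (_⊔_ τ A₁ A₂) (_⊔_ τ B₁ B₂) (pat τ S₁)
lemma3p3 τ k r A₁ A₂ B₁ B₂ S₁ S₂ win₁ win₂ same-pat no₁₂ no₂₁ =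
  let S , pat-S , endA-⊆ , endB-⊆ = parallel-play τ r S₁ S₂ same-pat (⊆ˢ-refl τ) (⊆ˢ-refl τ)
  in S , pat-S , λ match →
       ¬SomeMatch-⊔ τ win₁ no₁₂ no₂₁ win₂ (SomeMatch-⊆ˢ τ endA-⊆ endB-⊆ match)
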